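{- Let $G$ be a chemical reaction network with $s$ species whose underlying undirected graph is connected (i.e. $G$ is weakly connected), and let $\mathbf{w}_1,\dots,\mathbf{w}_k$ be a basis of integer vectors of its linear space of conservation law vectors. Then the steady-state ideal $I_G$ is multihomogeneous with respect to the multigrading specified by $\mathbf{w}_1,\dots,\mathbf{w}_k$.
   Context: A chemical reaction network is a finite directed graph $G$ without loops whose vertices (complexes) $\mathbf{y}_1,\dots,\mathbf{y}_m\in\mathbb{Z}_{\ge 0}^s$ are indexed by $s$ species; each reaction $\mathbf{y}_i\to\mathbf{y}_j$ carries a rate constant $\kappa_{ij}>0$. Under mass-action kinetics, $d\mathbf{x}/dt=\sum_{\mathbf{y}_i\to\mathbf{y}_j}\kappa_{ij}\mathbf{x}^{\mathbf{y}_i}(\mathbf{y}_j-\mathbf{y}_i)$ where $\mathbf{x}^{\mathbf{y}}=\prod_k x_k^{y_k}$; the steady-state ideal $I_G\subseteq\mathbb{C}[x_1,\dots,x_s]$ is generated by the $s$ coordinate polynomials of this right-hand side. The stoichiometric matrix $N$ has columns $\mathbf{y}_j-\mathbf{y}_i$ for the reactions; conservation law vectors are the $\mathbf{w}$ with $\mathbf{w}^tN=0$. An ideal $I\subseteq\mathbb{k}[x_1,\dots,x_s]$ is multihomogeneous with respect to the multigrading specified by integer vectors $\mathbf{w}_1,\dots,\mathbf{w}_k\in\mathbb{Z}^s$ if it has a generating set $f_1,\dots,f_{s-k}$ such that for each $f_i=\sum_{\mathbf{a}\in\mathcal{A}_i}\beta_{\mathbf{a}}\mathbf{x}^{\mathbf{a}}$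 (with $\mathcal{A}_i$ its support) we have $\mathbf{a}\cdot\mathbf{w}_j=\mathbf{b}\cdot\mathbf{w}_j$ for all $j\in[k]$ and all $\mathbf{a},\mathbf{b}\in\mathcal{A}_i$. -}

module Defs where

open import Level using (Level; _⊔_)
open import Algebra.Bundles using (CommutativeRing)
open import Data.Nat as ℕ using (ℕ; zero; suc; _∸_)
open import Data.Integer as ℤ using (ℤ; +_; -[1+_])
open import Data.Rational as ℚ using (ℚ; 0ℚ)
open import Data.Fin using (Fin; zero; suc)
open import Data.Vec as Vec using (Vec; zipWith; replicate; foldr)
open import Data.Vec.Properties using (≡-dec)
open import Data.List as List using (List; []; _∷_; _++_; concatMap)
open import Data.Product using (Σ; ∃; _×_; _,_)
open import Data.Sum using (_⊎_)
open import Relation.Nullary using (¬_; yes; no)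
open import Relation.Binary.PropositionalEquality using (_≡_; _≢_)
open import Relation.Binary.Construct.Closure.ReflexiveTransitive using (Star)
open import Function.Bundles using (_⇔_)

record CRN : Set where
  field
    s     : ℕ                       -- number of species
    m     : ℕ                       -- number of complexes (vertices)
    r     : ℕ                       -- number of reactions (edges)
    cpx   : Fin m → Vec ℕ s
    src   : Fin r → Fin m
    tgt   : Fin r → Fin m
    cpx-injective : ∀ i j → cpx i ≡ cpx j → i ≡ j
    no-loops      : ∀ ρ → src ρ ≢ tgt ρ
    no-multi      : ∀ ρ ρ′ → src ρ ≡ src ρ′ → tgt ρ ≡ tgt ρ′ → ρ ≡ ρ′

open CRN public

-- reaction vector y_tgt − y_src (a column of the stoichiometric matrix N)
column : (G : CRN) → Fin (r G) → Vec ℤ (s G)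
column G ρ = zipWith (λ a b → + a ℤ.- + b) (cpx G (tgt G ρ)) (cpx G (src G ρ))

Adjacent : (G : CRN) → Fin (m G) → Fin (m G) → Set
Adjacent G a b = ∃ λ ρ → (src G ρ ≡ a × tgt G ρ ≡ b) ⊎ (src G ρ ≡ b × tgt G ρ ≡ a)

WeaklyConnected : CRN → Set
WeaklyConnected G = ∀ a b → Star (Adjacent G) a b

dotℤ : ∀ {n} → Vec ℤ n → Vec ℤ n → ℤ
dotℤ u v = foldr _ ℤ._+_ (+ 0) (zipWith ℤ._*_ u v)

dotℚ : ∀ {n} → Vec ℚ n → Vec ℚ n → ℚ
dotℚ u v = foldr _ ℚ._+_ 0ℚ (zipWith ℚ._*_ u v)

toℚ : ∀ {n} → Vec ℤ n → Vec ℚ n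
toℚ = Vec.map (λ z → z ℚ./ 1)

natToℤ : ∀ {n} → Vec ℕ n → Vec ℤ n
natToℤ = Vec.map +_

IsConservationLawℚ : (G : CRN) → Vec ℚ (s G) → Set
IsConservationLawℚ G v = ∀ ρ → dotℚ v (toℚ (column G ρ)) ≡ 0ℚ

linComb : ∀ {n k} → (Fin k → ℚ) → (Fin k → Vec ℤ n) → Vec ℚ n
linComb {n} {zero}  c w = replicate n 0ℚ
linComb {n} {suc k} c w =
  zipWith ℚ._+_ (Vec.map (c zero ℚ.*_) (toℚ (w zero)))
                (linComb (λ j → c (suc j)) (λ j → w (suc j)))

record IsConservationBasis (G : CRN) (k : ℕ) (w : Fin k → Vec ℤ (s G)) : Set where
  field
    conserved   : ∀ j → IsConservationLawℚ G (toℚ (w j))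
    independent : ∀ (c : Fin k → ℚ) → linComb c w ≡ replicate (s G) 0ℚ → ∀ j → c j ≡ 0ℚ
    spanning    : ∀ v → IsConservationLawℚ G v → Σ (Fin k → ℚ) λ c → v ≡ linComb c w

module _ {c ℓ : Level} (R : CommutativeRing c ℓ) where
  open CommutativeRing R hiding (zero)

  natR : ℕ → Carrier
  natR zero    = 0#
  natR (suc n) = 1# + natR n

  intR : ℤ → Carrier
  intR (+ n)      = natR n
  intR -[1+ n ]   = - natR (suc n)

  record IsCharZeroField : Set (c ⊔ ℓ) where
    field
      char-zero : ∀ n → ¬ (natR (suc n) ≈ 0#)
      inverse   : ∀ x → ¬ (x ≈ 0#) → Σ Carrier λ y → (x * y) ≈ 1#

  -- a polynomial in s variables: a finite list of terms  c · x^a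
  Poly : ℕ → Set c
  Poly n = List (Carrier × Vec ℕ n)

  coeff : ∀ {n} → Poly n → Vec ℕ n → Carrier
  coeff []            a = 0#
  coeff ((d , e) ∷ p) a with ≡-dec ℕ._≟_ e a
  ... | yes _ = d + coeff p a
  ... | no  _ = coeff p a

  _≈P_ : ∀ {n} → Poly n → Poly n → Set ℓ
  p ≈P q = ∀ a → coeff p a ≈ coeff q a

  InSupport : ∀ {n} → Vec ℕ n → Poly n → Set ℓ
  InSupport a p = ¬ (coeff p a ≈ 0#)

  _+P_ : ∀ {n} → Poly n → Poly n → Poly n
  p +P q = p ++ q

  _*P_ : ∀ {n} → Poly n → Poly n → Poly n
  p *P q = concatMap (λ { (d , e) → List.map (λ { (d′ , e′) → (d * d′ , zipWith ℕ._+_ e e′) }) q }) p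

  sumP : ∀ {n k} → (Fin k → Poly n) → Poly n
  sumP {k = zero}  f = []
  sumP {k = suc k} f = f zero +P sumP (λ j → f (suc j))

  InIdeal : ∀ {n k} → (Fin k → Poly n) → Poly n → Set (c ⊔ ℓ)
  InIdeal {n} {k} g p = Σ (Fin k → Poly n) λ h → p ≈P sumP (λ j → h j *P g j)

  SameIdeal : ∀ {n k k′} → (Fin k → Poly n) → (Fin k′ → Poly n) → Set (c ⊔ ℓ)
  SameIdeal f g = ∀ p → InIdeal f p ⇔ InIdeal g p

  -- the s coordinate polynomials of  Σ_ρ κ_ρ x^(y_src ρ) (y_tgt ρ − y_src ρ)
  steadyStateGens : (G : CRN) → (Fin (r G) → Carrier) → Fin (s G) → Poly (s G)
  steadyStateGens G κ i =
    sumP (λ ρ → (κ ρ * intR (Vec.lookup (column G ρ) i) , cpx G (src G ρ)) ∷ [])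

  Multihomogeneous : ∀ {n k k′} → (Fin k′ → Poly n) → (Fin k → Vec ℤ n) → Set (c ⊔ ℓ)
  Multihomogeneous {n} {k} I w =
    Σ (Fin (n ∸ k) → Poly n) λ f →
      SameIdeal f I ×
      (∀ i j a b → InSupport a (f i) → InSupport b (f i) →
         dotℤ (natToℤ a) (w j) ≡ dotℤ (natToℤ b) (w j))

-- Each conservation law w gives the linear relation  Σᵢ wᵢ fᵢ = 0  among the coordinate
-- polynomials f₁ … f_s, since wᵀN = 0.  The k relations are independent, so fraction-free
-- Gaussian elimination removes k of the fᵢ without changing the ideal; this needs an
-- integer pivot to be invertible in K, i.e. characteristic zero.  Every fᵢ is supported on
-- source complexes, and w · y is the same for all complexes y: it is preserved along each
-- reaction (w · (y' − y) = 0) and the network is weakly connected.  So the s − k remaining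
-- generators are multihomogeneous.
module Submission where

open import Defs
open import Level using (Level)
open import Algebra.Bundles using (CommutativeRing)
open import Data.Nat as ℕ using (ℕ; zero; suc; _∸_)
import Data.Nat.Properties as ℕP
open import Data.Integer as ℤ using (ℤ; +_; -[1+_])
import Data.Integer.Properties as ℤP
open import Data.Integer.Tactic.RingSolver using (solve-∀)
open import Data.Rational as ℚ using (ℚ; 0ℚ)
import Data.Rational.Properties as ℚP
import Data.Rational.Unnormalised as ℚᵘ
import Data.Rational.Unnormalised.Properties as ℚᵘP
open import Data.Fin as Fin using (Fin; zero; suc; punchIn)
import Data.Fin.Properties as FinP
open import Data.Vec as Vec using (Vec; []; _∷_; lookup; zipWith)
import Data.Vec.Properties as VecP
open import Data.Vec.Properties using (≡-dec)
open import Data.Vec.Relation.Binary.Pointwise.Extensional using (ext; Pointwise-≡⇒≡)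
open import Data.Vec.Functional using (removeAt; insertAt)
open import Data.Vec.Functional.Properties using (insertAt-lookup; insertAt-punchIn)
open import Data.List using ([]; _∷_; _++_; concatMap)
open import Data.Product using (Σ; ∃; _,_; proj₁; proj₂)
open import Data.Sum using (inj₁; inj₂; fromInj₂)
open import Data.Empty using (⊥-elim)
open import Relation.Nullary using (¬_; yes; no; Dec; contradiction)
open import Relation.Binary.PropositionalEquality as ≡ using (_≡_; _≢_; refl; cong; cong₂)
open import Relation.Binary.Construct.Closure.ReflexiveTransitive using (Star; ε; _◅_)
open import Function using (_∘_; id)
open import Function.Bundles using (mk⇔)
open import Function.Construct.Identity using (⇔-id)
open import Function.Construct.Composition using (_⇔-∘_)
import Algebra.Properties.Semiring.Sum ℤP.+-*-semiring as ℤΣ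

fromℤ : ℤ → ℚ
fromℤ z = z ℚ./ 1

fromℚᵘ-homo-+ : ∀ p q → ℚ.fromℚᵘ (p ℚᵘ.+ q) ≡ ℚ.fromℚᵘ p ℚ.+ ℚ.fromℚᵘ q
fromℚᵘ-homo-+ p q = ℚP.toℚᵘ-injective (begin
    ℚ.toℚᵘ (ℚ.fromℚᵘ (p ℚᵘ.+ q))                   ≈⟨ ℚP.toℚᵘ-fromℚᵘ _ ⟩
    p ℚᵘ.+ q                                         ≈⟨ ℚᵘP.+-cong (≃-sym (ℚP.toℚᵘ-fromℚᵘ p)) (≃-sym (ℚP.toℚᵘ-fromℚᵘ q)) ⟩
    ℚ.toℚᵘ (ℚ.fromℚᵘ p) ℚᵘ.+ ℚ.toℚᵘ (ℚ.fromℚᵘ q)    ≈⟨ ≃-sym (ℚP.toℚᵘ-homo-+ (ℚ.fromℚᵘ p) (ℚ.fromℚᵘ q)) ⟩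
    ℚ.toℚᵘ (ℚ.fromℚᵘ p ℚ.+ ℚ.fromℚᵘ q)              ∎)
  where open ℚᵘP.≃-Reasoning; open ℚᵘP using (≃-sym)

fromℚᵘ-homo-* : ∀ p q → ℚ.fromℚᵘ (p ℚᵘ.* q) ≡ ℚ.fromℚᵘ p ℚ.* ℚ.fromℚᵘ q
fromℚᵘ-homo-* p q = ℚP.toℚᵘ-injective (begin
    ℚ.toℚᵘ (ℚ.fromℚᵘ (p ℚᵘ.* q))                   ≈⟨ ℚP.toℚᵘ-fromℚᵘ _ ⟩
    p ℚᵘ.* q                                         ≈⟨ ℚᵘP.*-cong (≃-sym (ℚP.toℚᵘ-fromℚᵘ p)) (≃-sym (ℚP.toℚᵘ-fromℚᵘ q)) ⟩
    ℚ.toℚᵘ (ℚ.fromℚᵘ p) ℚᵘ.* ℚ.toℚᵘ (ℚ.fromℚᵘ q)    ≈⟨ ≃-sym (ℚP.toℚᵘ-homo-* (ℚ.fromℚᵘ p) (ℚ.fromℚᵘ q)) ⟩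
    ℚ.toℚᵘ (ℚ.fromℚᵘ p ℚ.* ℚ.fromℚᵘ q)              ∎)
  where open ℚᵘP.≃-Reasoning; open ℚᵘP using (≃-sym)

-- fromℤ z is definitionally ℚ.fromℚᵘ (ℚᵘ.mkℚᵘ z 0).
fromℤ-+ : ∀ a b → fromℤ (a ℤ.+ b) ≡ fromℤ a ℚ.+ fromℤ b
fromℤ-+ a b = ≡.trans (ℚP.fromℚᵘ-cong {ℚᵘ.mkℚᵘ (a ℤ.+ b) 0} {ℚᵘ.mkℚᵘ a 0 ℚᵘ.+ ℚᵘ.mkℚᵘ b 0} (ℚᵘ.*≡* (identity a b)))
                      (fromℚᵘ-homo-+ (ℚᵘ.mkℚᵘ a 0) (ℚᵘ.mkℚᵘ b 0))
  where
  identity : ∀ a b → (a ℤ.+ b) ℤ.* + 1 ≡ (a ℤ.* + 1 ℤ.+ b ℤ.* + 1) ℤ.* + 1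
  identity = solve-∀

fromℤ-* : ∀ a b → fromℤ (a ℤ.* b) ≡ fromℤ a ℚ.* fromℤ b
fromℤ-* a b = fromℚᵘ-homo-* (ℚᵘ.mkℚᵘ a 0) (ℚᵘ.mkℚᵘ b 0)

fromℤ-injective : ∀ {a b} → fromℤ a ≡ fromℤ b → a ≡ b
fromℤ-injective {a} {b} eq with ℚP.fromℚᵘ-injective {ℚᵘ.mkℚᵘ a 0} {ℚᵘ.mkℚᵘ b 0} eq
... | ℚᵘ.*≡* a*1≡b*1 = ≡.trans (≡.sym (ℤP.*-identityʳ a)) (≡.trans a*1≡b*1 (ℤP.*-identityʳ b))

dotℚ-toℚ : ∀ {n} (u v : Vec ℤ n) → dotℚ (toℚ u) (toℚ v) ≡ fromℤ (dotℤ u v)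
dotℚ-toℚ []       []       = refl
dotℚ-toℚ (x ∷ xs) (y ∷ ys) =
  ≡.trans (cong₂ ℚ._+_ (≡.sym (fromℤ-* x y)) (dotℚ-toℚ xs ys)) (≡.sym (fromℤ-+ (x ℤ.* y) (dotℤ xs ys)))

lookup-linComb : ∀ {n k} (c : Fin k → ℤ) (w : Fin k → Vec ℤ n) i →
  lookup (linComb (fromℤ ∘ c) w) i ≡ fromℤ (ℤΣ.sum λ j → c j ℤ.* lookup (w j) i)
lookup-linComb {k = zero}  c w i = VecP.lookup-replicate i 0ℚ
lookup-linComb {k = suc k} c w i = begin
    lookup (zipWith ℚ._+_ first rest) i
      ≡⟨ VecP.lookup-zipWith ℚ._+_ i first rest ⟩
    lookup first i ℚ.+ lookup rest i
      ≡⟨ cong₂ ℚ._+_ (≡.trans (VecP.lookup-map i _ (toℚ (w zero)))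
                              (cong (fromℤ (c zero) ℚ.*_) (VecP.lookup-map i fromℤ (w zero))))
                     (lookup-linComb (c ∘ suc) (w ∘ suc) i) ⟩
    fromℤ (c zero) ℚ.* fromℤ (lookup (w zero) i) ℚ.+ fromℤ Σtail
      ≡⟨ cong (ℚ._+ fromℤ Σtail) (≡.sym (fromℤ-* (c zero) (lookup (w zero) i))) ⟩
    fromℤ (c zero ℤ.* lookup (w zero) i) ℚ.+ fromℤ Σtail
      ≡⟨ ≡.sym (fromℤ-+ (c zero ℤ.* lookup (w zero) i) Σtail) ⟩
    fromℤ (ℤΣ.sum λ j → c j ℤ.* lookup (w j) i) ∎
  where
  open ≡.≡-Reasoning
  first : Vec ℚ _
  first = Vec.map (fromℤ (c zero) ℚ.*_) (toℚ (w zero))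
  rest : Vec ℚ _
  rest = linComb (fromℤ ∘ c ∘ suc) (w ∘ suc)
  Σtail : ℤ
  Σtail = ℤΣ.sum λ j → c (suc j) ℤ.* lookup (w (suc j)) i

dotℤ-difference : ∀ {n} (w : Vec ℤ n) (t u : Vec ℕ n) →
  dotℤ w (zipWith (λ a b → + a ℤ.- + b) t u) ≡ dotℤ (natToℤ t) w ℤ.- dotℤ (natToℤ u) w
dotℤ-difference []      []      []      = refl
dotℤ-difference (x ∷ w) (a ∷ t) (b ∷ u) rewrite dotℤ-difference w t u =
  identity x (+ a) (+ b) (dotℤ (natToℤ t) w) (dotℤ (natToℤ u) w)
  where
  identity : ∀ x a b T U → x ℤ.* (a ℤ.- b) ℤ.+ (T ℤ.- U) ≡ (a ℤ.* x ℤ.+ T) ℤ.- (b ℤ.* x ℤ.+ U)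
  identity = solve-∀

Independent : ∀ {k n} → (Fin k → Fin n → ℤ) → Set
Independent {k} {n} v =
  ∀ (c : Fin k → ℤ) → (∀ i → ℤΣ.sum (λ j → c j ℤ.* v j i) ≡ + 0) → ∀ j → c j ≡ + 0

module _ {G : CRN} {k} {w : Fin k → Vec ℤ (s G)} (basis : IsConservationBasis G k w) where
  open IsConservationBasis basis

  dotℤ-column≡0 : ∀ j ρ → dotℤ (w j) (column G ρ) ≡ + 0
  dotℤ-column≡0 j ρ = fromℤ-injective (≡.trans (≡.sym (dotℚ-toℚ (w j) (column G ρ))) (conserved j ρ))

  conservationBasis-independent : Independent (λ j → lookup (w j))
  conservationBasis-independent c combination≡0 j = fromℤ-injective (independent (fromℤ ∘ c) linComb≡0 j)
    where
    linComb≡0 : linComb (fromℤ ∘ c) w ≡ Vec.replicate (s G) 0ℚ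
    linComb≡0 = Pointwise-≡⇒≡ (ext λ i →
      ≡.trans (lookup-linComb c w i)
              (≡.trans (cong fromℤ (combination≡0 i)) (≡.sym (VecP.lookup-replicate i 0ℚ))))

degree : (G : CRN) → Vec ℤ (s G) → Fin (m G) → ℤ
degree G w x = dotℤ (natToℤ (cpx G x)) w

module _ (G : CRN) (w : Vec ℤ (s G)) (conserved : ∀ ρ → dotℤ w (column G ρ) ≡ + 0) where

  degree-src≡tgt : ∀ ρ → degree G w (src G ρ) ≡ degree G w (tgt G ρ)
  degree-src≡tgt ρ = ≡.sym (ℤP.i-j≡0⇒i≡j _ _
    (≡.trans (≡.sym (dotℤ-difference w (cpx G (tgt G ρ)) (cpx G (src G ρ)))) (conserved ρ)))

  degree-adjacent : ∀ {x y} → Adjacent G x y → degree G w x ≡ degree G w y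
  degree-adjacent (ρ , inj₁ (refl , refl)) = degree-src≡tgt ρ
  degree-adjacent (ρ , inj₂ (refl , refl)) = ≡.sym (degree-src≡tgt ρ)

  degree-path : ∀ {x y} → Star (Adjacent G) x y → degree G w x ≡ degree G w y
  degree-path ε          = refl
  degree-path (xy ◅ yz) = ≡.trans (degree-adjacent xy) (degree-path yz)

punchIn-cases : ∀ {n} {P : Fin (suc n) → Set} p → P p → (∀ j → P (punchIn p j)) → ∀ i → P i
punchIn-cases {P = P} p Pp P∘punchIn i with p Fin.≟ i
... | yes refl = Pp
... | no  p≢i  = ≡.subst P (FinP.punchIn-punchOut p≢i) (P∘punchIn (Fin.punchOut p≢i))

independent⇒pivot : ∀ {k n} (v : Fin (suc k) → Fin n → ℤ) → Independent v → ∃ λ p → v zero p ≢ + 0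
independent⇒pivot {k} {n} v independent =
  FinP.¬∀⟶∃¬ n (λ i → v zero i ≡ + 0) (λ i → v zero i ℤ.≟ + 0) first-row≢0
  where
  first : Fin (suc k) → ℤ
  first zero    = + 1
  first (suc _) = + 0
  first-row≢0 : ¬ (∀ i → v zero i ≡ + 0)
  first-row≢0 row≡0 = contradiction (independent first combination≡0 zero) λ ()
    where
    combination≡0 : ∀ i → ℤΣ.sum (λ j → first j ℤ.* v j i) ≡ + 0
    combination≡0 i = cong₂ ℤ._+_ (cong (+ 1 ℤ.*_) (row≡0 i))
      (≡.trans (ℤΣ.sum-cong-≗ {k} (λ j → ℤP.*-zeroˡ (v (suc j) i))) (ℤΣ.sum-replicate-zero k))

-- Row j + 1 minus a multiple of row 0, scaled to stay in ℤ, so that column p becomes zero.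
clearColumn : ∀ {k n} → (Fin (suc k) → Fin n → ℤ) → Fin n → Fin k → Fin n → ℤ
clearColumn v p j i = v zero p ℤ.* v (suc j) i ℤ.- v (suc j) p ℤ.* v zero i

clearColumn-pivot : ∀ {k n} (v : Fin (suc k) → Fin n → ℤ) p j → clearColumn v p j p ≡ + 0
clearColumn-pivot v p j =
  ≡.trans (cong (ℤ._-_ (v zero p ℤ.* v (suc j) p)) (ℤP.*-comm (v (suc j) p) (v zero p)))
          (ℤP.+-inverseʳ (v zero p ℤ.* v (suc j) p))

eliminate : ∀ {k n} → (Fin (suc k) → Fin (suc n) → ℤ) → Fin (suc n) → Fin k → Fin n → ℤ
eliminate v p j = removeAt (clearColumn v p j) p

∑-combination-expand : ∀ {k} (c : Fin k → ℤ) a (x b : Fin k → ℤ) y →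
  ℤΣ.sum (λ j → c j ℤ.* (a ℤ.* x j ℤ.- b j ℤ.* y))
    ≡ (ℤ.- ℤΣ.sum (λ j → c j ℤ.* b j)) ℤ.* y ℤ.+ ℤΣ.sum (λ j → a ℤ.* c j ℤ.* x j)
∑-combination-expand {zero}  c a x b y = refl
∑-combination-expand {suc k} c a x b y rewrite ∑-combination-expand (c ∘ suc) a (x ∘ suc) (b ∘ suc) y =
  identity (c zero) a (x zero) (b zero) y (ℤΣ.sum (λ j → c (suc j) ℤ.* b (suc j)))
           (ℤΣ.sum (λ j → a ℤ.* c (suc j) ℤ.* x (suc j)))
  where
  identity : ∀ c a x b y B X →
    c ℤ.* (a ℤ.* x ℤ.- b ℤ.* y) ℤ.+ ((ℤ.- B) ℤ.* y ℤ.+ X)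
      ≡ (ℤ.- (c ℤ.* b ℤ.+ B)) ℤ.* y ℤ.+ (a ℤ.* c ℤ.* x ℤ.+ X)
  identity = solve-∀

eliminate-independent : ∀ {k n} (v : Fin (suc k) → Fin (suc n) → ℤ) p →
  v zero p ≢ + 0 → Independent v → Independent (eliminate v p)
eliminate-independent {k} v p pivot≢0 independent c combination≡0 j =
  fromInj₂ (⊥-elim ∘ pivot≢0) (ℤP.i*j≡0⇒i≡0∨j≡0 (v zero p) (independent c′ lifted≡0 (suc j)))
  where
  c′ : Fin (suc k) → ℤ
  c′ zero    = ℤ.- ℤΣ.sum (λ j → c j ℤ.* v (suc j) p)
  c′ (suc j) = v zero p ℤ.* c j
  cleared≡0 : ∀ i → ℤΣ.sum (λ j → c j ℤ.* clearColumn v p j i) ≡ + 0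
  cleared≡0 = punchIn-cases p
    (≡.trans (ℤΣ.sum-cong-≗ {k} (λ j → ≡.trans (cong (c j ℤ.*_) (clearColumn-pivot v p j)) (ℤP.*-zeroʳ (c j))))
             (ℤΣ.sum-replicate-zero k))
    combination≡0
  lifted≡0 : ∀ i → ℤΣ.sum (λ j → c′ j ℤ.* v j i) ≡ + 0
  lifted≡0 i = ≡.trans (≡.sym (∑-combination-expand c (v zero p) (λ j → v (suc j) i) (λ j → v (suc j) p) (v zero i)))
                       (cleared≡0 i)

_∣ᵐ_ : ∀ {n} → Vec ℕ n → Vec ℕ n → Set
e ∣ᵐ a = ∃ λ b → zipWith ℕ._+_ e b ≡ a

zipWith-+-cancelˡ : ∀ {n} (e x y : Vec ℕ n) → zipWith ℕ._+_ e x ≡ zipWith ℕ._+_ e y → x ≡ y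
zipWith-+-cancelˡ []       []       []       _  = refl
zipWith-+-cancelˡ (e ∷ es) (x ∷ xs) (y ∷ ys) eq =
  cong₂ _∷_ (ℕP.+-cancelˡ-≡ e x y (VecP.∷-injectiveˡ eq)) (zipWith-+-cancelˡ es xs ys (VecP.∷-injectiveʳ eq))

zipWith-+-∸ : ∀ {n} (e b : Vec ℕ n) → zipWith ℕ._∸_ (zipWith ℕ._+_ e b) e ≡ b
zipWith-+-∸ []       []       = refl
zipWith-+-∸ (e ∷ es) (b ∷ bs) = cong₂ _∷_ (ℕP.m+n∸m≡n e b) (zipWith-+-∸ es bs)

_∣ᵐ?_ : ∀ {n} (e a : Vec ℕ n) → Dec (e ∣ᵐ a)
e ∣ᵐ? a with ≡-dec ℕ._≟_ (zipWith ℕ._+_ e (zipWith ℕ._∸_ a e)) a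
... | yes e∣a = yes (_ , e∣a)
... | no  e∤a = no λ { (b , refl) → e∤a (cong (zipWith ℕ._+_ e) (zipWith-+-∸ e b)) }

module _ {c ℓ} (K : CommutativeRing c ℓ) where
  open CommutativeRing K hiding (zero) renaming (refl to ≈-refl)
  open import Algebra.Properties.Ring ring
    using (-‿distribˡ-*; -‿distribʳ-*; -‿involutive; +-inverseˡ-unique; -0#≈0#; -‿+-comm; xyx⁻¹≈y)
  open import Algebra.Properties.CommutativeSemigroup *-commutativeSemigroup using (x∙yz≈y∙xz)
  open import Algebra.Properties.Semiring.Mult semiring using (×-homo-+; ×1-homo-*) renaming (_×_ to _×ₙ_)
  open import Algebra.Properties.Semiring.Sum semiring
    using (sum; sum-remove; ∑-distrib-+; sum-cong-≋; sum-replicate-zero; *-distribˡ-sum; ∑-comm)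
  open import Relation.Binary.Reasoning.Setoid setoid

  natR≡×1 : ∀ n → natR K n ≡ n ×ₙ 1#
  natR≡×1 zero    = refl
  natR≡×1 (suc n) = cong (_+_ 1#) (natR≡×1 n)

  natR-+ : ∀ m n → natR K (m ℕ.+ n) ≈ natR K m + natR K n
  natR-+ m n rewrite natR≡×1 (m ℕ.+ n) | natR≡×1 m | natR≡×1 n = ×-homo-+ 1# m n

  natR-* : ∀ m n → natR K (m ℕ.* n) ≈ natR K m * natR K n
  natR-* m n rewrite natR≡×1 (m ℕ.* n) | natR≡×1 m | natR≡×1 n = ×1-homo-* m n

  intR-neg : ∀ z → intR K (ℤ.- z) ≈ - intR K z
  intR-neg (+ zero)  = sym -0#≈0#
  intR-neg (+ suc n) = ≈-refl
  intR-neg -[1+ n ]  = sym (-‿involutive _)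

  intR-⊖ : ∀ m n → intR K (m ℤ.⊖ n) ≈ natR K m + - natR K n
  intR-⊖ m zero = begin
    intR K (m ℤ.⊖ 0)   ≡⟨ cong (intR K) (ℤP.⊖-≥ {m} {0} ℕ.z≤n) ⟩
    natR K m           ≈⟨ sym (+-identityʳ _) ⟩
    natR K m + 0#      ≈⟨ +-congˡ (sym -0#≈0#) ⟩
    natR K m + - 0#    ∎
  intR-⊖ zero (suc n) = ≡.subst (λ z → intR K z ≈ 0# + - natR K (suc n))
    (≡.sym (ℤP.⊖-< {0} {suc n} (ℕ.s≤s ℕ.z≤n))) (sym (+-identityˡ (- natR K (suc n))))
  intR-⊖ (suc m) (suc n) = begin
    intR K (suc m ℤ.⊖ suc n)                         ≡⟨ cong (intR K) (ℤP.[1+m]⊖[1+n]≡m⊖n m n) ⟩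
    intR K (m ℤ.⊖ n)                                 ≈⟨ intR-⊖ m n ⟩
    natR K m + - natR K n                            ≈⟨ +-congʳ (sym (xyx⁻¹≈y 1# (natR K m))) ⟩
    ((1# + natR K m) + - 1#) + - natR K n            ≈⟨ +-assoc _ _ _ ⟩
    (1# + natR K m) + (- 1# + - natR K n)            ≈⟨ +-congˡ (-‿+-comm 1# _) ⟩
    natR K (suc m) + - natR K (suc n)                ∎

  intR-+ : ∀ x y → intR K (x ℤ.+ y) ≈ intR K x + intR K y
  intR-+ (+ m)    (+ n)    = natR-+ m n
  intR-+ (+ m)    -[1+ n ] = intR-⊖ m (suc n)
  intR-+ -[1+ m ] (+ n)    = trans (intR-⊖ n (suc m)) (+-comm _ _)
  intR-+ -[1+ m ] -[1+ n ] = begin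
    - natR K (suc (suc (m ℕ.+ n)))        ≡⟨ cong (λ t → - natR K (suc t)) (≡.sym (ℕP.+-suc m n)) ⟩
    - natR K (suc m ℕ.+ suc n)            ≈⟨ -‿cong (natR-+ (suc m) (suc n)) ⟩
    - (natR K (suc m) + natR K (suc n))   ≈⟨ sym (-‿+-comm _ _) ⟩
    - natR K (suc m) + - natR K (suc n)   ∎

  intR-*-+ : ∀ m y → intR K (+ m ℤ.* y) ≈ natR K m * intR K y
  intR-*-+ m (+ n) = trans (reflexive (cong (intR K) (≡.sym (ℤP.pos-* m n)))) (natR-* m n)
  intR-*-+ m -[1+ n ] = begin
    intR K (+ m ℤ.* -[1+ n ])         ≡⟨ cong (intR K) (≡.sym (ℤP.neg-distribʳ-* (+ m) (+ suc n))) ⟩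
    intR K (ℤ.- (+ m ℤ.* + suc n))    ≈⟨ intR-neg (+ m ℤ.* + suc n) ⟩
    - intR K (+ m ℤ.* + suc n)        ≈⟨ -‿cong (intR-*-+ m (+ suc n)) ⟩
    - (natR K m * natR K (suc n))     ≈⟨ -‿distribʳ-* _ _ ⟩
    natR K m * - natR K (suc n)       ∎

  intR-* : ∀ x y → intR K (x ℤ.* y) ≈ intR K x * intR K y
  intR-* (+ m)    y = intR-*-+ m y
  intR-* -[1+ m ] y = begin
    intR K (-[1+ m ] ℤ.* y)           ≡⟨ cong (intR K) (≡.sym (ℤP.neg-distribˡ-* (+ suc m) y)) ⟩
    intR K (ℤ.- (+ suc m ℤ.* y))      ≈⟨ intR-neg (+ suc m ℤ.* y) ⟩
    - intR K (+ suc m ℤ.* y)          ≈⟨ -‿cong (intR-*-+ (suc m) y) ⟩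
    - (natR K (suc m) * intR K y)     ≈⟨ -‿distribˡ-* _ _ ⟩
    - natR K (suc m) * intR K y       ∎

  intR-dotℤ : ∀ {n} (u v : Vec ℤ n) → intR K (dotℤ u v) ≈ sum (λ i → intR K (lookup u i) * intR K (lookup v i))
  intR-dotℤ []       []       = ≈-refl
  intR-dotℤ (x ∷ xs) (y ∷ ys) = trans (intR-+ (x ℤ.* y) (dotℤ xs ys)) (+-cong (intR-* x y) (intR-dotℤ xs ys))

  intR-invertible : IsCharZeroField K → ∀ {z} → z ≢ + 0 → ∃ λ y → intR K z * y ≈ 1#
  intR-invertible F {+ zero}  z≢0 = ⊥-elim (z≢0 refl)
  intR-invertible F {+ suc n} z≢0 = IsCharZeroField.inverse F _ (IsCharZeroField.char-zero F n)
  intR-invertible F { -[1+ n ] } z≢0 = IsCharZeroField.inverse F _ λ -n≈0 →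
    IsCharZeroField.char-zero F n (trans (sym (-‿involutive _)) (trans (-‿cong -n≈0) -0#≈0#))

  private
    infixl 7 _⋆_
    _⋆_ : ∀ {n} → Poly K n → Poly K n → Poly K n
    _⋆_ = _*P_ K

  coeff-++ : ∀ {n} (p q : Poly K n) a → coeff K (p ++ q) a ≈ coeff K p a + coeff K q a
  coeff-++ []            q a = sym (+-identityˡ _)
  coeff-++ ((d , e) ∷ p) q a with ≡-dec ℕ._≟_ e a
  ... | yes _ = trans (+-congˡ (coeff-++ p q a)) (sym (+-assoc _ _ _))
  ... | no  _ = coeff-++ p q a

  coeff-sumP : ∀ {n k} (f : Fin k → Poly K n) a → coeff K (sumP K f) a ≈ sum (λ j → coeff K (f j) a)
  coeff-sumP {k = zero}  f a = ≈-refl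
  coeff-sumP {k = suc k} f a = trans (coeff-++ (f zero) _ a) (+-congˡ (coeff-sumP (f ∘ suc) a))

  coeff-singleton-* : ∀ {n} x y (e a : Vec ℕ n) → coeff K ((x * y , e) ∷ []) a ≈ coeff K ((x , e) ∷ []) a * y
  coeff-singleton-* x y e a with ≡-dec ℕ._≟_ e a
  ... | yes _ = trans (+-identityʳ _) (*-congʳ (sym (+-identityʳ _)))
  ... | no  _ = sym (zeroˡ y)

  coeff-singleton-≢ : ∀ {n} x (e a : Vec ℕ n) → e ≢ a → coeff K ((x , e) ∷ []) a ≈ 0#
  coeff-singleton-≢ x e a e≢a with ≡-dec ℕ._≟_ e a
  ... | yes e≡a = ⊥-elim (e≢a e≡a)
  ... | no  _   = ≈-refl

  coeff-∷-⋆ : ∀ {n} d (e : Vec ℕ n) p q a →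
    coeff K (((d , e) ∷ p) ⋆ q) a ≈ coeff K (((d , e) ∷ []) ⋆ q) a + coeff K (p ⋆ q) a
  coeff-∷-⋆ d e p q a = concatMap-∷ _ (d , e) p
    where
    concatMap-∷ : ∀ f t p → coeff K (concatMap f (t ∷ p)) a ≈ coeff K (concatMap f (t ∷ [])) a + coeff K (concatMap f p) a
    concatMap-∷ f t p = trans (coeff-++ (f t) (concatMap f p) a)
                              (+-congʳ (sym (trans (coeff-++ (f t) [] a) (+-identityʳ (coeff K (f t) a)))))

  coeff-++-⋆ : ∀ {n} (p p′ q : Poly K n) a → coeff K ((p ++ p′) ⋆ q) a ≈ coeff K (p ⋆ q) a + coeff K (p′ ⋆ q) a
  coeff-++-⋆ []            p′ q a = sym (+-identityˡ _)
  coeff-++-⋆ ((d , e) ∷ p) p′ q a = begin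
    coeff K (((d , e) ∷ (p ++ p′)) ⋆ q) a                          ≈⟨ coeff-∷-⋆ d e (p ++ p′) q a ⟩
    coeff K (t ⋆ q) a + coeff K ((p ++ p′) ⋆ q) a                   ≈⟨ +-congˡ (coeff-++-⋆ p p′ q a) ⟩
    coeff K (t ⋆ q) a + (coeff K (p ⋆ q) a + coeff K (p′ ⋆ q) a)    ≈⟨ sym (+-assoc _ _ _) ⟩
    (coeff K (t ⋆ q) a + coeff K (p ⋆ q) a) + coeff K (p′ ⋆ q) a    ≈⟨ +-congʳ (sym (coeff-∷-⋆ d e p q a)) ⟩
    coeff K (((d , e) ∷ p) ⋆ q) a + coeff K (p′ ⋆ q) a              ∎
    where t = (d , e) ∷ []

  coeff-monomial-⋆ : ∀ {n} d (e : Vec ℕ n) q a b → zipWith ℕ._+_ e b ≡ a →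
    coeff K (((d , e) ∷ []) ⋆ q) a ≈ d * coeff K q b
  coeff-monomial-⋆ d e [] a b e+b≡a = sym (zeroʳ d)
  coeff-monomial-⋆ d e ((d′ , e′) ∷ q) a b e+b≡a
    with ≡-dec ℕ._≟_ (zipWith ℕ._+_ e e′) a | ≡-dec ℕ._≟_ e′ b
  ... | yes _      | yes _    = trans (+-congˡ (coeff-monomial-⋆ d e q a b e+b≡a)) (sym (distribˡ d d′ _))
  ... | yes e+e′≡a | no e′≢b  = ⊥-elim (e′≢b (zipWith-+-cancelˡ e e′ b (≡.trans e+e′≡a (≡.sym e+b≡a))))
  ... | no e+e′≢a  | yes e′≡b = ⊥-elim (e+e′≢a (≡.trans (cong (zipWith ℕ._+_ e) e′≡b) e+b≡a))
  ... | no _       | no _     = coeff-monomial-⋆ d e q a b e+b≡a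

  coeff-monomial-⋆-∤ : ∀ {n} d (e : Vec ℕ n) q a → ¬ (e ∣ᵐ a) → coeff K (((d , e) ∷ []) ⋆ q) a ≈ 0#
  coeff-monomial-⋆-∤ d e [] a e∤a = ≈-refl
  coeff-monomial-⋆-∤ d e ((d′ , e′) ∷ q) a e∤a with ≡-dec ℕ._≟_ (zipWith ℕ._+_ e e′) a
  ... | yes e+e′≡a = ⊥-elim (e∤a (e′ , e+e′≡a))
  ... | no  _      = coeff-monomial-⋆-∤ d e q a e∤a

  scaleP : ∀ {n} → Carrier → Poly K n → Poly K n
  scaleP x []            = []
  scaleP x ((d , e) ∷ h) = (x * d , e) ∷ scaleP x h

  record IsLinearCombination {n k} (cs : Fin k → Carrier) (g : Fin k → Poly K n) (q : Poly K n) : Set ℓ where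
    constructor linearCombination
    field coeff-≈ : ∀ a → coeff K q a ≈ sum (λ i → cs i * coeff K (g i) a)

  record IsLinearRelation {n k} (v : Fin k → Carrier) (g : Fin k → Poly K n) : Set ℓ where
    constructor linearRelation
    field coeff-≈0 : ∀ a → sum (λ i → v i * coeff K (g i) a) ≈ 0#

  module _ {n k} {cs : Fin k → Carrier} {g : Fin k → Poly K n} {q : Poly K n}
           (q≈∑csg : IsLinearCombination cs g q) where

    monomial-⋆-linearCombination : ∀ d e a →
      coeff K (((d , e) ∷ []) ⋆ q) a ≈ sum (λ i → coeff K (((cs i * d , e) ∷ []) ⋆ g i) a)
    monomial-⋆-linearCombination d e a with e ∣ᵐ? a
    ... | yes (b , e+b≡a) = begin
      coeff K (((d , e) ∷ []) ⋆ q) a                   ≈⟨ coeff-monomial-⋆ d e q a b e+b≡a ⟩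
      d * coeff K q b                                  ≈⟨ *-congˡ (IsLinearCombination.coeff-≈ q≈∑csg b) ⟩
      d * sum (λ i → cs i * coeff K (g i) b)           ≈⟨ *-distribˡ-sum d (λ i → cs i * coeff K (g i) b) ⟩
      sum (λ i → d * (cs i * coeff K (g i) b))         ≈⟨ sum-cong-≋ (λ i → trans (sym (*-assoc _ _ _)) (*-congʳ (*-comm d (cs i)))) ⟩
      sum (λ i → (cs i * d) * coeff K (g i) b)         ≈⟨ sum-cong-≋ (λ i → sym (coeff-monomial-⋆ (cs i * d) e (g i) a b e+b≡a)) ⟩
      sum (λ i → coeff K (((cs i * d , e) ∷ []) ⋆ g i) a) ∎
    ... | no e∤a = trans (coeff-monomial-⋆-∤ d e q a e∤a)
      (trans (sym (sum-replicate-zero k)) (sum-cong-≋ λ i → sym (coeff-monomial-⋆-∤ _ e (g i) a e∤a)))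

    ⋆-linearCombination : ∀ h a → coeff K (h ⋆ q) a ≈ sum (λ i → coeff K (scaleP (cs i) h ⋆ g i) a)
    ⋆-linearCombination []            a = sym (sum-replicate-zero k)
    ⋆-linearCombination ((d , e) ∷ h) a = begin
      coeff K (((d , e) ∷ h) ⋆ q) a
        ≈⟨ coeff-∷-⋆ d e h q a ⟩
      coeff K (((d , e) ∷ []) ⋆ q) a + coeff K (h ⋆ q) a
        ≈⟨ +-cong (monomial-⋆-linearCombination d e a) (⋆-linearCombination h a) ⟩
      sum (λ i → coeff K (((cs i * d , e) ∷ []) ⋆ g i) a) + sum (λ i → coeff K (scaleP (cs i) h ⋆ g i) a)
        ≈⟨ sym (∑-distrib-+ (λ i → coeff K (((cs i * d , e) ∷ []) ⋆ g i) a) (λ i → coeff K (scaleP (cs i) h ⋆ g i) a)) ⟩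
      sum (λ i → coeff K (((cs i * d , e) ∷ []) ⋆ g i) a + coeff K (scaleP (cs i) h ⋆ g i) a)
        ≈⟨ sum-cong-≋ (λ i → sym (coeff-∷-⋆ (cs i * d) e (scaleP (cs i) h) (g i) a)) ⟩
      sum (λ i → coeff K (scaleP (cs i) ((d , e) ∷ h) ⋆ g i) a) ∎

  module _ {s′ n} (g : Fin (suc n) → Poly K s′) (p : Fin (suc n)) where

    InIdeal-removeAt : ∀ {q} → InIdeal K (removeAt g p) q → InIdeal K g q
    InIdeal-removeAt {q} (h , q≈∑hg) = h′ , λ a → begin
      coeff K q a                                             ≈⟨ q≈∑hg a ⟩
      coeff K (sumP K (λ j → h j ⋆ g (punchIn p j))) a         ≈⟨ coeff-sumP (λ j → h j ⋆ g (punchIn p j)) a ⟩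
      sum (λ j → coeff K (h j ⋆ g (punchIn p j)) a)            ≈⟨ sym (+-identityˡ _) ⟩
      0# + sum (λ j → coeff K (h j ⋆ g (punchIn p j)) a)       ≈⟨ +-cong (at p (insertAt-lookup h p [])) (sum-cong-≋ λ j →
                                                                   at (punchIn p j) (insertAt-punchIn h p [] j)) ⟩
      coeff K (h′ p ⋆ g p) a + sum (λ j → coeff K (h′ (punchIn p j) ⋆ g (punchIn p j)) a)
                                                              ≈⟨ sym (sum-remove {i = p} (λ i → coeff K (h′ i ⋆ g i) a)) ⟩
      sum (λ i → coeff K (h′ i ⋆ g i) a)                       ≈⟨ sym (coeff-sumP (λ i → h′ i ⋆ g i) a) ⟩
      coeff K (sumP K (λ i → h′ i ⋆ g i)) a                    ∎
      where
      h′ : Fin (suc n) → Poly K s′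
      h′ = insertAt h p []
      at : ∀ {a} i {f} → h′ i ≡ f → coeff K (f ⋆ g i) a ≈ coeff K (h′ i ⋆ g i) a
      at i h′i≡f = reflexive (cong (λ f → coeff K (f ⋆ g i) _) (≡.sym h′i≡f))

    InIdeal-removeAt-redundant : ∀ {cs q} → IsLinearCombination cs (removeAt g p) (g p) →
      InIdeal K g q → InIdeal K (removeAt g p) q
    InIdeal-removeAt-redundant {cs} {q} gp≈∑ (h , q≈∑hg) = h′ , λ a → begin
      coeff K q a                                        ≈⟨ q≈∑hg a ⟩
      coeff K (sumP K (λ i → h i ⋆ g i)) a                ≈⟨ coeff-sumP (λ i → h i ⋆ g i) a ⟩
      sum (λ i → coeff K (h i ⋆ g i) a)                   ≈⟨ sum-remove {i = p} (λ i → coeff K (h i ⋆ g i) a) ⟩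
      coeff K (h p ⋆ g p) a + sum (λ j → coeff K (h (punchIn p j) ⋆ g (punchIn p j)) a)
                                                         ≈⟨ +-congʳ (⋆-linearCombination gp≈∑ (h p) a) ⟩
      sum (λ j → coeff K (scaleP (cs j) (h p) ⋆ g (punchIn p j)) a)
        + sum (λ j → coeff K (h (punchIn p j) ⋆ g (punchIn p j)) a)
                                                         ≈⟨ +-comm _ _ ⟩
      sum (λ j → coeff K (h (punchIn p j) ⋆ g (punchIn p j)) a)
        + sum (λ j → coeff K (scaleP (cs j) (h p) ⋆ g (punchIn p j)) a)
                                                         ≈⟨ sym (∑-distrib-+ (λ j → coeff K (h (punchIn p j) ⋆ g (punchIn p j)) a)
                                                                  (λ j → coeff K (scaleP (cs j) (h p) ⋆ g (punchIn p j)) a)) ⟩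
      sum (λ j → coeff K (h (punchIn p j) ⋆ g (punchIn p j)) a
               + coeff K (scaleP (cs j) (h p) ⋆ g (punchIn p j)) a)
                                                         ≈⟨ sum-cong-≋ (λ j → sym (coeff-++-⋆ (h (punchIn p j)) _ _ a)) ⟩
      sum (λ j → coeff K (h′ j ⋆ g (punchIn p j)) a)      ≈⟨ sym (coeff-sumP (λ j → h′ j ⋆ g (punchIn p j)) a) ⟩
      coeff K (sumP K (λ j → h′ j ⋆ g (punchIn p j))) a   ∎
      where
      h′ : Fin n → Poly K s′
      h′ j = h (punchIn p j) ++ scaleP (cs j) (h p)

    SameIdeal-removeAt : ∀ {cs} → IsLinearCombination cs (removeAt g p) (g p) → SameIdeal K (removeAt g p) g
    SameIdeal-removeAt gp≈∑ q = mk⇔ (InIdeal-removeAt {q}) (InIdeal-removeAt-redundant {q = q} gp≈∑)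

    pivot-linearCombination : ∀ {v : Fin (suc n) → Carrier} {y} → v p * y ≈ 1# → IsLinearRelation v g →
      IsLinearCombination (λ j → (- y) * v (punchIn p j)) (removeAt g p) (g p)
    pivot-linearCombination {v} {y} vp*y≈1 (linearRelation ∑vg≈0) = linearCombination solved
      where
      solved : ∀ a → coeff K (g p) a ≈ sum (λ j → ((- y) * v (punchIn p j)) * coeff K (g (punchIn p j)) a)
      solved a = begin
        C                                         ≈⟨ sym (*-identityˡ _) ⟩
        1# * C                                    ≈⟨ *-congʳ (trans (sym vp*y≈1) (*-comm _ _)) ⟩
        (y * v p) * C                             ≈⟨ *-assoc _ _ _ ⟩
        y * (v p * C)                             ≈⟨ *-congˡ (+-inverseˡ-unique _ _ vpC+S≈0) ⟩
        y * - S                                   ≈⟨ sym (-‿distribʳ-* y S) ⟩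
        - (y * S)                                 ≈⟨ -‿distribˡ-* y S ⟩
        (- y) * S                                 ≈⟨ *-distribˡ-sum (- y) (λ j → v (punchIn p j) * coeff K (g (punchIn p j)) a) ⟩
        sum (λ j → (- y) * (v (punchIn p j) * coeff K (g (punchIn p j)) a))
                                                  ≈⟨ sum-cong-≋ (λ j → sym (*-assoc (- y) (v (punchIn p j)) (coeff K (g (punchIn p j)) a))) ⟩
        sum (λ j → ((- y) * v (punchIn p j)) * coeff K (g (punchIn p j)) a) ∎
        where
        C = coeff K (g p) a
        S = sum (λ j → v (punchIn p j) * coeff K (g (punchIn p j)) a)
        vpC+S≈0 : v p * C + S ≈ 0#
        vpC+S≈0 = trans (sym (sum-remove {i = p} (λ i → v i * coeff K (g i) a))) (∑vg≈0 a)

  module _ {n k} {g : Fin k → Poly K n} where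

    IsLinearRelation-cong : ∀ {u u′} → (∀ i → u i ≈ u′ i) → IsLinearRelation u g → IsLinearRelation u′ g
    IsLinearRelation-cong u≈u′ (linearRelation ∑ug≈0) = linearRelation λ a → trans (sum-cong-≋ (λ i → *-congʳ (sym (u≈u′ i)))) (∑ug≈0 a)

    IsLinearRelation-combine : ∀ {u u′} x y → IsLinearRelation u g → IsLinearRelation u′ g →
      IsLinearRelation (λ i → x * u i + y * u′ i) g
    IsLinearRelation-combine {u} {u′} x y (linearRelation ∑ug≈0) (linearRelation ∑u′g≈0) = linearRelation λ a → begin
      sum (λ i → (x * u i + y * u′ i) * coeff K (g i) a)
        ≈⟨ sum-cong-≋ (λ i → trans (distribʳ (coeff K (g i) a) (x * u i) (y * u′ i))
                                    (+-cong (*-assoc x (u i) (coeff K (g i) a)) (*-assoc y (u′ i) (coeff K (g i) a)))) ⟩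
      sum (λ i → x * (u i * coeff K (g i) a) + y * (u′ i * coeff K (g i) a))
        ≈⟨ ∑-distrib-+ (λ i → x * (u i * coeff K (g i) a)) (λ i → y * (u′ i * coeff K (g i) a)) ⟩
      sum (λ i → x * (u i * coeff K (g i) a)) + sum (λ i → y * (u′ i * coeff K (g i) a))
        ≈⟨ sym (+-cong (*-distribˡ-sum x (λ i → u i * coeff K (g i) a)) (*-distribˡ-sum y (λ i → u′ i * coeff K (g i) a))) ⟩
      x * sum (λ i → u i * coeff K (g i) a) + y * sum (λ i → u′ i * coeff K (g i) a)
        ≈⟨ +-cong (*-congˡ (∑ug≈0 a)) (*-congˡ (∑u′g≈0 a)) ⟩
      x * 0# + y * 0#
        ≈⟨ trans (+-cong (zeroʳ x) (zeroʳ y)) (+-identityˡ 0#) ⟩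
      0# ∎

  IsLinearRelation-removeAt : ∀ {s′ n} {u : Fin (suc n) → Carrier} {g : Fin (suc n) → Poly K s′} p →
    u p ≈ 0# → IsLinearRelation u g → IsLinearRelation (removeAt u p) (removeAt g p)
  IsLinearRelation-removeAt {u = u} {g} p up≈0 (linearRelation ∑ug≈0) = linearRelation λ a → begin
    sum (λ j → u (punchIn p j) * coeff K (g (punchIn p j)) a)          ≈⟨ sym (+-identityˡ _) ⟩
    0# + sum (λ j → u (punchIn p j) * coeff K (g (punchIn p j)) a)     ≈⟨ +-congʳ (sym (trans (*-congʳ up≈0) (zeroˡ _))) ⟩
    u p * coeff K (g p) a + sum (λ j → u (punchIn p j) * coeff K (g (punchIn p j)) a)
                                                                      ≈⟨ sym (sum-remove {i = p} (λ i → u i * coeff K (g i) a)) ⟩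
    sum (λ i → u i * coeff K (g i) a)                                  ≈⟨ ∑ug≈0 a ⟩
    0#                                                                 ∎

  eliminate-relation : ∀ {s′ k n} (g : Fin (suc n) → Poly K s′) (v : Fin (suc k) → Fin (suc n) → ℤ) p →
    (∀ j → IsLinearRelation (intR K ∘ v j) g) → ∀ j → IsLinearRelation (intR K ∘ eliminate v p j) (removeAt g p)
  eliminate-relation g v p relations j =
    IsLinearRelation-removeAt {u = intR K ∘ clearColumn v p j} p (reflexive (cong (intR K) (clearColumn-pivot v p j)))
      (IsLinearRelation-cong intR-clearColumn
        (IsLinearRelation-combine (intR K (v zero p)) (- intR K (v (suc j) p)) (relations (suc j)) (relations zero)))
    where
    intR-clearColumn : ∀ i → intR K (v zero p) * intR K (v (suc j) i) + - intR K (v (suc j) p) * intR K (v zero i)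
                               ≈ intR K (clearColumn v p j i)
    intR-clearColumn i = sym (begin
      intR K (v zero p ℤ.* v (suc j) i ℤ.+ ℤ.- (v (suc j) p ℤ.* v zero i))
        ≈⟨ intR-+ (v zero p ℤ.* v (suc j) i) (ℤ.- (v (suc j) p ℤ.* v zero i)) ⟩
      intR K (v zero p ℤ.* v (suc j) i) + intR K (ℤ.- (v (suc j) p ℤ.* v zero i))
        ≈⟨ +-cong (intR-* (v zero p) (v (suc j) i))
                  (trans (intR-neg (v (suc j) p ℤ.* v zero i)) (-‿cong (intR-* (v (suc j) p) (v zero i)))) ⟩
      intR K (v zero p) * intR K (v (suc j) i) + - (intR K (v (suc j) p) * intR K (v zero i))
        ≈⟨ +-congˡ (-‿distribˡ-* _ _) ⟩
      intR K (v zero p) * intR K (v (suc j) i) + - intR K (v (suc j) p) * intR K (v zero i) ∎)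

  dropRelations : IsCharZeroField K → ∀ {s′ n k} (g : Fin n → Poly K s′) (v : Fin k → Fin n → ℤ) →
    Independent v → (∀ j → IsLinearRelation (intR K ∘ v j) g) →
    Σ (Fin (n ∸ k) → Fin n) λ σ → SameIdeal K (g ∘ σ) g
  dropRelations F {k = zero} g v independent relations = id , λ q → ⇔-id _
  dropRelations F {n = zero} {suc k} g v independent relations with independent⇒pivot v independent
  ... | () , _
  dropRelations F {n = suc n} {suc k} g v independent relations with independent⇒pivot v independent
  ... | p , pivot≢0 = punchIn p ∘ proj₁ reduced , λ q → SameIdeal-removeAt g p pivot-combination q ⇔-∘ proj₂ reduced q
    where
    reduced = dropRelations F (removeAt g p) (eliminate v p)
      (eliminate-independent v p pivot≢0 independent) (eliminate-relation g v p relations)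
    pivot-combination = pivot-linearCombination g p {v = intR K ∘ v zero} (proj₂ (intR-invertible F pivot≢0)) (relations zero)

  module _ (G : CRN) (κ : Fin (r G) → Carrier) where

    private
      term : Fin (s G) → Fin (r G) → Poly K (s G)
      term i ρ = (κ ρ * intR K (lookup (column G ρ) i) , cpx G (src G ρ)) ∷ []

    coeff-steadyStateGens : ∀ i a → coeff K (steadyStateGens K G κ i) a
      ≈ sum (λ ρ → coeff K ((κ ρ , cpx G (src G ρ)) ∷ []) a * intR K (lookup (column G ρ) i))
    coeff-steadyStateGens i a = trans (coeff-sumP (term i) a)
      (sum-cong-≋ λ ρ → coeff-singleton-* (κ ρ) (intR K (lookup (column G ρ) i)) (cpx G (src G ρ)) a)

    steadyState-relation : ∀ (w : Vec ℤ (s G)) → (∀ ρ → dotℤ w (column G ρ) ≡ + 0) →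
      IsLinearRelation (intR K ∘ lookup w) (steadyStateGens K G κ)
    steadyState-relation w conserved = linearRelation vanishes
      where
      vanishes : ∀ a → sum (λ i → intR K (lookup w i) * coeff K (steadyStateGens K G κ i) a) ≈ 0#
      vanishes a = begin
        sum (λ i → W i * coeff K (steadyStateGens K G κ i) a)  ≈⟨ sum-cong-≋ (λ i → *-congˡ (coeff-steadyStateGens i a)) ⟩
        sum (λ i → W i * sum (λ ρ → δ ρ * N ρ i))              ≈⟨ sum-cong-≋ (λ i → *-distribˡ-sum (W i) (λ ρ → δ ρ * N ρ i)) ⟩
        sum (λ i → sum (λ ρ → W i * (δ ρ * N ρ i)))            ≈⟨ ∑-comm (λ i ρ → W i * (δ ρ * N ρ i)) ⟩
        sum (λ ρ → sum (λ i → W i * (δ ρ * N ρ i)))            ≈⟨ sum-cong-≋ (λ ρ → sum-cong-≋ λ i → x∙yz≈y∙xz (W i) (δ ρ) (N ρ i)) ⟩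
        sum (λ ρ → sum (λ i → δ ρ * (W i * N ρ i)))            ≈⟨ sum-cong-≋ (λ ρ → sym (*-distribˡ-sum (δ ρ) (λ i → W i * N ρ i))) ⟩
        sum (λ ρ → δ ρ * sum (λ i → W i * N ρ i))              ≈⟨ sum-cong-≋ (λ ρ → *-congˡ (sym (intR-dotℤ w (column G ρ)))) ⟩
        sum (λ ρ → δ ρ * intR K (dotℤ w (column G ρ)))         ≈⟨ sum-cong-≋ (λ ρ → trans (*-congˡ (reflexive (cong (intR K) (conserved ρ)))) (zeroʳ _)) ⟩
        sum {r G} (λ _ → 0#)                                    ≈⟨ sum-replicate-zero (r G) ⟩
        0#                                                      ∎
        where
        W : Fin (s G) → Carrier
        W i = intR K (lookup w i)
        N : Fin (r G) → Fin (s G) → Carrier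
        N ρ i = intR K (lookup (column G ρ) i)
        δ : Fin (r G) → Carrier
        δ ρ = coeff K ((κ ρ , cpx G (src G ρ)) ∷ []) a

    steadyStateGens-support : ∀ {i a} → InSupport K a (steadyStateGens K G κ i) → ∃ λ ρ → cpx G (src G ρ) ≡ a
    steadyStateGens-support {i} {a} a∈f with FinP.any? (λ ρ → ≡-dec ℕ._≟_ (cpx G (src G ρ)) a)
    ... | yes source = source
    ... | no  ¬source = ⊥-elim (a∈f (begin
      coeff K (steadyStateGens K G κ i) a    ≈⟨ coeff-sumP (term i) a ⟩
      sum (λ ρ → coeff K ((κ ρ * intR K (lookup (column G ρ) i) , cpx G (src G ρ)) ∷ []) a)
                                            ≈⟨ sum-cong-≋ (λ ρ → coeff-singleton-≢ _ _ a (λ eq → ¬source (ρ , eq))) ⟩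
      sum {r G} (λ _ → 0#)                   ≈⟨ sum-replicate-zero (r G) ⟩
      0#                                     ∎))

    steadyStateGens-homogeneous : WeaklyConnected G → ∀ (w : Vec ℤ (s G)) → (∀ ρ → dotℤ w (column G ρ) ≡ + 0) →
      ∀ {i a b} → InSupport K a (steadyStateGens K G κ i) → InSupport K b (steadyStateGens K G κ i) →
      dotℤ (natToℤ a) w ≡ dotℤ (natToℤ b) w
    steadyStateGens-homogeneous connected w conserved a∈f b∈f
      with steadyStateGens-support a∈f | steadyStateGens-support b∈f
    ... | ρ , refl | ρ′ , refl = degree-path G w conserved (connected (src G ρ) (src G ρ′))

-- A zero rate constant only deletes terms.
proposition3p4 : ∀ {c ℓ : Level} (K : CommutativeRing c ℓ) → IsCharZeroField K →
    (G : CRN) → WeaklyConnected G →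
    (κ : Fin (r G) → CommutativeRing.Carrier K) →
    (∀ ρ → ¬ (CommutativeRing._≈_ K (κ ρ) (CommutativeRing.0# K))) →
    (k : ℕ) (w : Fin k → Vec ℤ (s G)) → IsConservationBasis G k w →
    Multihomogeneous K (steadyStateGens K G κ) w
proposition3p4 K F G connected κ _ k w basis =
  f ∘ proj₁ reduction , proj₂ reduction ,
  λ i j a b → steadyStateGens-homogeneous K G κ connected (w j) (dotℤ-column≡0 basis j)
  where
  f = steadyStateGens K G κ
  reduction : Σ (Fin (s G ∸ k) → Fin (s G)) λ σ → SameIdeal K (f ∘ σ) f
  reduction = dropRelations K F f (λ j → lookup (w j)) (conservationBasis-independent basis)
                (λ j → steadyState-relation K G κ (w j) (dotℤ-column≡0 basis j))
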